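{- Let $p\geq5$ be prime, $2\leq b\leq p$, $1\leq c\leq p-1$, $s=b+c(p-1)$, $r=s+p^t(p-1)d$ with integers $t\geq2$, $d\geq1$, $p\nmid d$. Suppose $c-1\leq b\leq p$ and $1\leq m\leq\min\{b-c,c-1-\epsilon\}$. Let $A=(\alpha(i,l))_{1\leq i\leq m+1,\,0\leq l\leq m}$ (defined in the context). Then for every $1\leq i\leq m$, the linear system $AX\equiv e_i\pmod p$ has a solution $X\in\mathbb{Z}_p^{m+1}$, where $e_i$ is the $i$-th standard basis vector of $\mathbb{Z}_p^{m+1}$.
   Context: Binomial convention: for $n\in\mathbb{Z}_{\geq0}$, $\binom nk=0$ if $k<0$ or $k>n$. $\epsilon$: $0$ if $2c-1\leq b\leq p$; $1$ if $2(c-1)-p\leq b\leq 2(c-1)$; $2$ if $2\leq b\leq 2(c-1)-(p+1)$. $\epsilon_1$: $0$ if $2m+1\leq b\leq p$; $1$ if $2m+1-(p-1)\leq b\leq 2m$; $2$ if $2\leq b\leq 2m-(p-1)$. $\beta(a,i)$ ($a\geq1$, $1\leq i\leq m+1$): $\beta(1,i)=\binom{m+1}{i}$, $\beta(a,i)=\sum_{l=1}^{a-1}(-1)^{l+1}\binom{m+1}{l}\beta(a-l,i)+(-1)^{a-1}\binom{m+1}{i+a-1}$ for $a\geq2$. For $0\leq l\leq p-1$, $1\leq i\leq m+1$: $\alpha_1(i,l)=(-1)^{i+1}\sum_{a=1}^{c-m-\epsilon_1}\binom{r-l}{b-m+(c-m-a)(p-1)}\beta(a,i)$, and $\alpha(i,l)=\alpha_1(i,l)+\binom{r-l}{b-m+(i+c-m-1)(p-1)}$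 if $1\leq i\leq m$, $\alpha(m+1,l)=\alpha_1(m+1,l)$. -}

module Defs where

open import Data.Nat as ℕ using (ℕ; zero; suc; _∸_; _≤ᵇ_)
open import Data.Nat.Combinatorics using (_C_)
open import Data.Integer as ℤ using (ℤ; +_; -_)
open import Data.Bool using (if_then_else_)
open import Data.List using (List; map; foldr; upTo)

-- sum_{k = lo}^{hi} f k  in ℤ (empty, i.e. 0, when hi < lo)
Σ[_⋯_] : ℕ → ℕ → (ℕ → ℤ) → ℤ
Σ[ lo ⋯ hi ] f = foldr ℤ._+_ (+ 0) (map (λ k → f (lo ℕ.+ k)) (upTo (suc hi ∸ lo)))

sgn : ℕ → ℤ
sgn n = (- (+ 1)) ℤ.^ n

binom : ℕ → ℕ → ℤ
binom n k = + (n C k)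

module Alpha (p b c r m : ℕ) where

  -- ε : 0 if 2c-1 ≤ b ≤ p ; 1 if 2(c-1)-p ≤ b ≤ 2(c-1) ; 2 if 2 ≤ b ≤ 2(c-1)-(p+1)
  ε : ℕ
  ε = if 2 ℕ.* c ≤ᵇ b ℕ.+ 1 then 0
      else if 2 ℕ.* c ∸ 2 ≤ᵇ b ℕ.+ p then 1 else 2

  -- ε₁ : 0 if 2m+1 ≤ b ≤ p ; 1 if 2m+1-(p-1) ≤ b ≤ 2m ; 2 if 2 ≤ b ≤ 2m-(p-1)
  ε₁ : ℕ
  ε₁ = if 2 ℕ.* m ℕ.+ 1 ≤ᵇ b then 0
       else if 2 ℕ.* m ℕ.+ 1 ≤ᵇ b ℕ.+ (p ∸ 1) then 1 else 2

  -- β(a,i) via fuel (fuel ≥ a suffices; β a i = βaux a a i)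
  βaux : ℕ → ℕ → ℕ → ℤ
  βaux zero a i = + 0
  βaux (suc f) a i =
    if a ≤ᵇ 1 then binom (suc m) i
    else (Σ[ 1 ⋯ a ∸ 1 ] (λ l → sgn (suc l) ℤ.* binom (suc m) l ℤ.* βaux f (a ∸ l) i)
          ℤ.+ sgn (a ∸ 1) ℤ.* binom (suc m) (i ℕ.+ a ∸ 1))

  β : ℕ → ℕ → ℤ
  β a i = βaux a a i

  α₁ : ℕ → ℕ → ℤ
  α₁ i l = sgn (suc i) ℤ.*
    Σ[ 1 ⋯ c ∸ m ∸ ε₁ ] (λ a →
      binom (r ∸ l) (b ∸ m ℕ.+ (c ∸ m ∸ a) ℕ.* (p ∸ 1)) ℤ.* β a i)

  -- α(i,l) for 1 ≤ i ≤ m+1, 0 ≤ l ≤ p-1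
  α : ℕ → ℕ → ℤ
  α i l = if i ≤ᵇ m
          then α₁ i l ℤ.+ binom (r ∸ l) (b ∸ m ℕ.+ (i ℕ.+ c ∸ m ∸ 1) ℕ.* (p ∸ 1))
          else α₁ i l

open import Data.Fin using (Fin)
open import Data.List using (allFin)

ΣFin : (n : ℕ) → (Fin n → ℤ) → ℤ
ΣFin n f = foldr ℤ._+_ (+ 0) (map f (allFin n))

{-# OPTIONS --safe #-}
module Submission where

-- Modulo p every binomial entry C(r − l, b − m + J(p − 1)) of A can be read off with Lucas's
-- theorem: r − l = (M p + c) p + (b − c − l) with M = p^(t−2) (p − 1) d (this is where t ≥ 2
-- enters) and b − m + J(p − 1) = J p + (b − m − J), so the entry is C(b − c − l, b − m − J) C(c, J).
-- The α₁-part only has J ≤ c − m − 1, whose lower digit exceeds b − c − l for all l ≤ m, so α₁ ≡ 0.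
-- The extra term of row j + 1 has J = j + c − m and lower digit b − c − j: it vanishes for l > j
-- and equals C(c, J) ≢ 0 on the diagonal. Hence A is lower triangular mod p, with invertible
-- diagonal in the first m rows and a zero last row, and forward substitution solves A X ≡ e_i
-- because the last coordinate of e_i is 0.

open import Defs
open import Data.Nat as ℕ using (ℕ; suc; _≤_; _∸_; _^_)
open import Data.Nat.Primality using (Prime)
open import Data.Nat.Divisibility as ℕD using ()
open import Data.Integer as ℤ using (ℤ; +_)
open import Data.Integer.Divisibility as ℤD using ()
open import Data.Fin using (Fin; toℕ)
open import Data.Product using (Σ)
open import Relation.Nullary using (¬_)
open import Data.Bool using (if_then_else_)

open import Data.Nat using (zero; pred; _<_; _!; z≤n; s≤s; z<s; NonZero)
open import Data.Nat.Properties
open import Data.Nat.Combinatorics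
  using (_C_; nCk≡n!/k![n-k]!; k![n∸k]!∣n!; nCk+nC[k+1]≡[n+1]C[k+1]; nCn≡1; k>n⇒nCk≡0)
open import Data.Nat.DivMod using (m/n*n≡m)
open import Data.Nat.Divisibility using (_∣_; ∣-trans; m∣m*n; ∣⇒≤; ∣1⇒≡1)
open import Data.Nat.Primality using (euclidsLemma; prime⇒irreducible; prime⇒nonTrivial; prime⇒nonZero)
open import Data.Nat.Coprimality using (Coprime; coprime-Bézout)
open import Data.Nat.GCD using (module Bézout)
import Data.Nat.Tactic.RingSolver as ℕ-Solver
open import Data.Integer using (_+_; _*_; _-_; -_; 0ℤ; 1ℤ)
import Data.Integer.Properties as ℤP
open import Data.Integer.Divisibility.Signed
  using (divides; ∣ᵤ⇒∣; ∣⇒∣ᵤ; ∣m∣n⇒∣m+n; ∣m⇒∣-m; ∣m⇒∣m*n; ∣n⇒∣m*n)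
  renaming (_∣_ to _∣ℤ_)
open import Data.Integer.Tactic.RingSolver using (solve-∀)
open import Data.Product using (∃; _,_; _×_; proj₁; proj₂)
import Data.Product as Product
import Data.Sum as Sum
open import Data.Bool using (true; false; T)
open import Data.Unit using (tt)
import Data.Fin as Fin
open import Data.Fin.Properties using (toℕ≤pred[n])
open import Data.List using ([]; _∷_; map; foldr; allFin; upTo)
open import Data.List.Properties using (map-tabulate)
open import Data.Sum using (_⊎_; inj₁; inj₂)
open import Data.Empty using (⊥-elim)
open import Function using (_∘_)
open import Relation.Binary.Bundles using (Setoid)
open import Relation.Binary.Structures using (IsEquivalence)
open import Relation.Binary.PropositionalEquality
  using (_≡_; refl; sym; trans; cong; cong₂; subst; module ≡-Reasoning)

module Congruence (n : ℕ) where

  -- A record rather than a bare divisibility, so that a and b can be inferred.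
  infix 4 _≈_
  record _≈_ (a b : ℤ) : Set where
    constructor mk≈
    field divides-difference : + n ∣ℤ a - b

  open _≈_ public

  ≈-refl : ∀ {a} → a ≈ a
  ≈-refl {a} = mk≈ (divides 0ℤ (a-a≡0*n a (+ n)))
    where a-a≡0*n : ∀ a n → a - a ≡ 0ℤ * n
          a-a≡0*n = solve-∀

  ≈-reflexive : ∀ {a b} → a ≡ b → a ≈ b
  ≈-reflexive refl = ≈-refl

  ≈-sym : ∀ {a b} → a ≈ b → b ≈ a
  ≈-sym {a} {b} (mk≈ n∣a-b) = mk≈ (subst (+ n ∣ℤ_) (-[a-b]≡b-a a b) (∣m⇒∣-m n∣a-b))
    where -[a-b]≡b-a : ∀ a b → - (a - b) ≡ b - a
          -[a-b]≡b-a = solve-∀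

  ≈-trans : ∀ {a b c} → a ≈ b → b ≈ c → a ≈ c
  ≈-trans {a} {b} {c} (mk≈ n∣a-b) (mk≈ n∣b-c) =
    mk≈ (subst (+ n ∣ℤ_) (telescope a b c) (∣m∣n⇒∣m+n n∣a-b n∣b-c))
    where telescope : ∀ a b c → (a - b) + (b - c) ≡ a - c
          telescope = solve-∀

  ≈-isEquivalence : IsEquivalence _≈_
  ≈-isEquivalence = record { refl = ≈-refl ; sym = ≈-sym ; trans = ≈-trans }

  setoid : Setoid _ _
  setoid = record { isEquivalence = ≈-isEquivalence }

  +-cong : ∀ {a b c d} → a ≈ b → c ≈ d → a + c ≈ b + d
  +-cong {a} {b} {c} {d} (mk≈ n∣a-b) (mk≈ n∣c-d) =
    mk≈ (subst (+ n ∣ℤ_) (regroup a b c d) (∣m∣n⇒∣m+n n∣a-b n∣c-d))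
    where regroup : ∀ a b c d → (a - b) + (c - d) ≡ (a + c) - (b + d)
          regroup = solve-∀

  -‿cong : ∀ {a b} → a ≈ b → - a ≈ - b
  -‿cong {a} {b} (mk≈ n∣a-b) = mk≈ (subst (+ n ∣ℤ_) (negate a b) (∣m⇒∣-m n∣a-b))
    where negate : ∀ a b → - (a - b) ≡ - a - - b
          negate = solve-∀

  *-cong : ∀ {a b c d} → a ≈ b → c ≈ d → a * c ≈ b * d
  *-cong {a} {b} {c} {d} (mk≈ n∣a-b) (mk≈ n∣c-d) =
    mk≈ (subst (+ n ∣ℤ_) (regroup a b c d) (∣m∣n⇒∣m+n (∣m⇒∣m*n c n∣a-b) (∣n⇒∣m*n b n∣c-d)))
    where regroup : ∀ a b c d → (a - b) * c + b * (c - d) ≡ a * c - b * d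
          regroup = solve-∀

  a≈0⇒a*b≈0 : ∀ {a} b → a ≈ 0ℤ → a * b ≈ 0ℤ
  a≈0⇒a*b≈0 b a≈0 = *-cong a≈0 (≈-refl {b})

  b≈0⇒a*b≈0 : ∀ a {b} → b ≈ 0ℤ → a * b ≈ 0ℤ
  b≈0⇒a*b≈0 a b≈0 = ≈-trans (*-cong (≈-refl {a}) b≈0) (≈-reflexive (ℤP.*-zeroʳ a))

  ∣⇒≈0 : ∀ {k} → n ∣ k → + k ≈ 0ℤ
  ∣⇒≈0 {k} n∣k = mk≈ (subst (+ n ∣ℤ_) (k≡k-0 (+ k)) (∣ᵤ⇒∣ n∣k))
    where k≡k-0 : ∀ k → k ≡ k - 0ℤ
          k≡k-0 = solve-∀

  Invertible : ℤ → Set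
  Invertible a = ∃ λ u → a * u ≈ 1ℤ

  invertible-resp-≈ : ∀ {a b} → a ≈ b → Invertible b → Invertible a
  invertible-resp-≈ {a} a≈b (u , bu≈1) = u , ≈-trans (*-cong a≈b (≈-refl {u})) bu≈1

prime∤n! : ∀ {p n} → Prime p → n < p → ¬ p ∣ n !
prime∤n! {p} {zero} p-prime _ p∣1 = ℕ.nonTrivial⇒≢1 {{prime⇒nonTrivial p-prime}} (∣1⇒≡1 p∣1)
prime∤n! {p} {suc n} p-prime 1+n<p p∣[1+n]! with euclidsLemma (suc n) (n !) p-prime p∣[1+n]!
... | inj₁ p∣1+n = <⇒≱ 1+n<p (∣⇒≤ p∣1+n)
... | inj₂ p∣n! = prime∤n! p-prime (<-trans (n<1+n n) 1+n<p) p∣n!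

nCk*[k!*[n∸k]!]≡n! : ∀ {n k} → k ≤ n → (n C k) ℕ.* (k ! ℕ.* (n ∸ k) !) ≡ n !
nCk*[k!*[n∸k]!]≡n! {n} {k} k≤n =
  trans (cong (ℕ._* (k ! ℕ.* (n ∸ k) !)) (nCk≡n!/k![n-k]! k≤n))
        (m/n*n≡m {{k !* (n ∸ k) !≢0}} (k![n∸k]!∣n! k≤n))

prime∤nCk : ∀ {p n k} → Prime p → n < p → k ≤ n → ¬ p ∣ n C k
prime∤nCk p-prime n<p k≤n p∣nCk =
  prime∤n! p-prime n<p (subst (_ ∣_) (nCk*[k!*[n∸k]!]≡n! k≤n) (∣-trans p∣nCk (m∣m*n _)))

prime∣pCk : ∀ {p k} → Prime p → 0 < k → k < p → p ∣ p C k
prime∣pCk {suc q} {k} p-prime 0<k k<p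
  with euclidsLemma (suc q C k) (k ! ℕ.* (suc q ∸ k) !) p-prime
         (subst (suc q ∣_) (sym (nCk*[k!*[n∸k]!]≡n! (<⇒≤ k<p))) (m∣m*n (q !)))
... | inj₁ p∣pCk = p∣pCk
... | inj₂ p∣k!*[p∸k]! with euclidsLemma (k !) ((suc q ∸ k) !) p-prime p∣k!*[p∸k]!
...   | inj₁ p∣k! = ⊥-elim (prime∤n! p-prime k<p p∣k!)
...   | inj₂ p∣[p∸k]! = ⊥-elim (prime∤n! p-prime (∸-monoʳ-< 0<k (<⇒≤ k<p)) p∣[p∸k]!)

prime∤⇒coprime : ∀ {p a} → Prime p → ¬ p ∣ a → Coprime a p
prime∤⇒coprime p-prime p∤a (d∣a , d∣p) with prime⇒irreducible p-prime d∣p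
... | inj₁ d≡1 = d≡1
... | inj₂ refl = ⊥-elim (p∤a d∣a)

pos[1+m*n] : ∀ m n → + (1 ℕ.+ m ℕ.* n) ≡ 1ℤ + + m * + n
pos[1+m*n] m n = trans (ℤP.pos-+ 1 (m ℕ.* n)) (cong (_+_ 1ℤ) (ℤP.pos-* m n))

module _ {p : ℕ} (p-prime : Prime p) where

  open Congruence p
  open ≡-Reasoning

  prime∤⇒invertible : ∀ {a} → ¬ p ∣ a → Invertible (+ a)
  prime∤⇒invertible {a} p∤a with coprime-Bézout (prime∤⇒coprime p-prime p∤a)
  ... | Bézout.+- x y eq = + x , mk≈ (divides (+ y) (begin
    + a * + x - 1ℤ       ≡⟨ cong (_- 1ℤ) (ℤP.*-comm (+ a) (+ x)) ⟩
    + x * + a - 1ℤ       ≡⟨ cong (_- 1ℤ) x*a≡1+y*p ⟩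
    1ℤ + + y * + p - 1ℤ  ≡⟨ cancel 1ℤ (+ y * + p) ⟩
    + y * + p            ∎))
    where
      x*a≡1+y*p : + x * + a ≡ 1ℤ + + y * + p
      x*a≡1+y*p = trans (sym (ℤP.pos-* x a)) (trans (cong +_ (sym eq)) (pos[1+m*n] y p))
      cancel : ∀ u v → u + v - u ≡ v
      cancel = solve-∀
  ... | Bézout.-+ x y eq = - + x , mk≈ (divides (- + y) (begin
    + a * - + x - 1ℤ      ≡⟨ negate (+ a) (+ x) ⟩
    - (1ℤ + + x * + a)    ≡⟨ cong -_ 1+x*a≡y*p ⟩
    - (+ y * + p)         ≡⟨ ℤP.neg-distribˡ-* (+ y) (+ p) ⟩
    - + y * + p           ∎))
    where
      1+x*a≡y*p : 1ℤ + + x * + a ≡ + y * + p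
      1+x*a≡y*p = trans (sym (pos[1+m*n] x a)) (trans (cong +_ eq) (ℤP.pos-* y p))
      negate : ∀ a x → a * - x - 1ℤ ≡ - (1ℤ + x * a)
      negate = solve-∀

n<k⇒binom≡0 : ∀ {n k} → n < k → binom n k ≡ 0ℤ
n<k⇒binom≡0 n<k = cong +_ (k>n⇒nCk≡0 n<k)

pascal : ∀ n k → binom (suc n) (suc k) ≡ binom n k + binom n (suc k)
pascal n k = cong +_ (sym (nCk+nC[k+1]≡[n+1]C[k+1] n k))

module BinomialsModPrime {p : ℕ} (p-prime : Prime p) where

  open Congruence p
  open import Relation.Binary.Reasoning.Setoid setoid

  private
    0<p : 0 < p
    0<p = ℕ.>-nonZero⁻¹ p {{prime⇒nonZero p-prime}}

    q : ℕ
    q = pred p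

    p≡1+q : p ≡ suc q
    p≡1+q = sym (suc-pred p {{prime⇒nonZero p-prime}})

    q<p : q < p
    q<p = subst (q <_) (sym p≡1+q) (n<1+n q)

    pascal-p : ∀ n → binom (suc n) p ≡ binom n q + binom n p
    pascal-p n = trans (cong (binom (suc n)) p≡1+q)
                       (trans (pascal n q) (cong (λ k → binom n q + binom n k) (sym p≡1+q)))

  [n+p]Ck≈nCk : ∀ n k → k < p → binom (n ℕ.+ p) k ≈ binom n k
  [n+p]Ck≈nCk zero zero _ = ≈-refl
  [n+p]Ck≈nCk zero (suc k) k<p = ∣⇒≈0 (prime∣pCk p-prime z<s k<p)
  [n+p]Ck≈nCk (suc n) zero _ = ≈-refl
  [n+p]Ck≈nCk (suc n) (suc k) k<p = begin
    binom (suc n ℕ.+ p) (suc k)                  ≡⟨ pascal (n ℕ.+ p) k ⟩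
    binom (n ℕ.+ p) k + binom (n ℕ.+ p) (suc k)  ≈⟨ +-cong ([n+p]Ck≈nCk n k (<-trans (n<1+n k) k<p))
                                                          ([n+p]Ck≈nCk n (suc k) k<p) ⟩
    binom n k + binom n (suc k)                  ≡⟨ pascal n k ⟨
    binom (suc n) (suc k)                        ∎

  [n+p]C[k+p]≈nC[k+p]+nCk : ∀ n k → binom (n ℕ.+ p) (k ℕ.+ p) ≈ binom n (k ℕ.+ p) + binom n k
  [n+p]C[k+p]≈nC[k+p]+nCk zero zero = begin
    binom p p              ≡⟨ cong +_ (nCn≡1 p) ⟩
    1ℤ                     ≡⟨ cong (_+ 1ℤ) (n<k⇒binom≡0 0<p) ⟨
    binom 0 p + binom 0 0  ∎
  [n+p]C[k+p]≈nC[k+p]+nCk zero (suc k) = ≈-reflexive (n<k⇒binom≡0 (s≤s (m≤n+m p k)))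
  [n+p]C[k+p]≈nC[k+p]+nCk (suc n) zero = begin
    binom (suc n ℕ.+ p) p                  ≡⟨ pascal-p (n ℕ.+ p) ⟩
    binom (n ℕ.+ p) q + binom (n ℕ.+ p) p  ≈⟨ +-cong ([n+p]Ck≈nCk n q q<p) ([n+p]C[k+p]≈nC[k+p]+nCk n zero) ⟩
    binom n q + (binom n p + 1ℤ)           ≡⟨ ℤP.+-assoc (binom n q) (binom n p) 1ℤ ⟨
    binom n q + binom n p + 1ℤ             ≡⟨ cong (_+ 1ℤ) (pascal-p n) ⟨
    binom (suc n) p + 1ℤ                   ∎
  [n+p]C[k+p]≈nC[k+p]+nCk (suc n) (suc k) = begin
    binom (suc n ℕ.+ p) (suc k ℕ.+ p)
      ≡⟨ pascal (n ℕ.+ p) (k ℕ.+ p) ⟩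
    binom (n ℕ.+ p) (k ℕ.+ p) + binom (n ℕ.+ p) (suc k ℕ.+ p)
      ≈⟨ +-cong ([n+p]C[k+p]≈nC[k+p]+nCk n k) ([n+p]C[k+p]≈nC[k+p]+nCk n (suc k)) ⟩
    (binom n (k ℕ.+ p) + binom n k) + (binom n (suc k ℕ.+ p) + binom n (suc k))
      ≡⟨ interchange (binom n (k ℕ.+ p)) (binom n k) (binom n (suc k ℕ.+ p)) (binom n (suc k)) ⟩
    (binom n (k ℕ.+ p) + binom n (suc k ℕ.+ p)) + (binom n k + binom n (suc k))
      ≡⟨ cong₂ _+_ (pascal n (k ℕ.+ p)) (pascal n k) ⟨
    binom (suc n) (suc k ℕ.+ p) + binom (suc n) (suc k)
      ∎
    where interchange : ∀ a b c d → (a + b) + (c + d) ≡ (a + c) + (b + d)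
          interchange = solve-∀

  [1+Y]*p+x≡Y*p+x+p : ∀ Y x → suc Y ℕ.* p ℕ.+ x ≡ Y ℕ.* p ℕ.+ x ℕ.+ p
  [1+Y]*p+x≡Y*p+x+p Y x = trans (+-assoc p (Y ℕ.* p) x) (+-comm p (Y ℕ.* p ℕ.+ x))

  lucas : ∀ Y x K k → x < p → k < p →
          binom (Y ℕ.* p ℕ.+ x) (K ℕ.* p ℕ.+ k) ≈ binom x k * binom Y K
  lucas zero x zero k _ _ = ≈-reflexive (sym (ℤP.*-identityʳ (binom x k)))
  lucas zero x (suc K) k x<p _ = begin
    binom x (suc K ℕ.* p ℕ.+ k)
      ≡⟨ n<k⇒binom≡0 (<-≤-trans x<p (≤-trans (m≤m+n p (K ℕ.* p)) (m≤m+n _ k))) ⟩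
    0ℤ
      ≡⟨ ℤP.*-zeroʳ (binom x k) ⟨
    binom x k * 0ℤ
      ∎
  lucas (suc Y) x zero k x<p k<p = begin
    binom (suc Y ℕ.* p ℕ.+ x) k          ≡⟨ cong (λ n → binom n k) ([1+Y]*p+x≡Y*p+x+p Y x) ⟩
    binom (Y ℕ.* p ℕ.+ x ℕ.+ p) k        ≈⟨ [n+p]Ck≈nCk (Y ℕ.* p ℕ.+ x) k k<p ⟩
    binom (Y ℕ.* p ℕ.+ x) k              ≈⟨ lucas Y x zero k x<p k<p ⟩
    binom x k * binom (suc Y) zero       ∎
  lucas (suc Y) x (suc K) k x<p k<p = begin
    binom (suc Y ℕ.* p ℕ.+ x) (suc K ℕ.* p ℕ.+ k)
      ≡⟨ cong₂ binom ([1+Y]*p+x≡Y*p+x+p Y x) ([1+Y]*p+x≡Y*p+x+p K k) ⟩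
    binom (Y ℕ.* p ℕ.+ x ℕ.+ p) (K ℕ.* p ℕ.+ k ℕ.+ p)
      ≈⟨ [n+p]C[k+p]≈nC[k+p]+nCk (Y ℕ.* p ℕ.+ x) (K ℕ.* p ℕ.+ k) ⟩
    binom (Y ℕ.* p ℕ.+ x) (K ℕ.* p ℕ.+ k ℕ.+ p) + binom (Y ℕ.* p ℕ.+ x) (K ℕ.* p ℕ.+ k)
      ≡⟨ cong (λ n → binom (Y ℕ.* p ℕ.+ x) n + binom (Y ℕ.* p ℕ.+ x) (K ℕ.* p ℕ.+ k))
              ([1+Y]*p+x≡Y*p+x+p K k) ⟨
    binom (Y ℕ.* p ℕ.+ x) (suc K ℕ.* p ℕ.+ k) + binom (Y ℕ.* p ℕ.+ x) (K ℕ.* p ℕ.+ k)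
      ≈⟨ +-cong (lucas Y x (suc K) k x<p k<p) (lucas Y x K k x<p k<p) ⟩
    binom x k * binom Y (suc K) + binom x k * binom Y K
      ≡⟨ ℤP.*-distribˡ-+ (binom x k) (binom Y (suc K)) (binom Y K) ⟨
    binom x k * (binom Y (suc K) + binom Y K)
      ≡⟨ cong (binom x k *_) (trans (ℤP.+-comm (binom Y (suc K)) (binom Y K)) (sym (pascal Y K))) ⟩
    binom x k * binom (suc Y) (suc K)
      ∎

  lucas₂ : ∀ M c x J k → c < p → x < p → J < p → k < p →
           binom ((M ℕ.* p ℕ.+ c) ℕ.* p ℕ.+ x) (J ℕ.* p ℕ.+ k) ≈ binom x k * binom c J
  lucas₂ M c x J k c<p x<p J<p k<p = begin
    binom ((M ℕ.* p ℕ.+ c) ℕ.* p ℕ.+ x) (J ℕ.* p ℕ.+ k)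
      ≈⟨ lucas (M ℕ.* p ℕ.+ c) x J k x<p k<p ⟩
    binom x k * binom (M ℕ.* p ℕ.+ c) J
      ≈⟨ *-cong (≈-refl {binom x k}) (lucas M c 0 J c<p J<p) ⟩
    binom x k * (binom c J * 1ℤ)
      ≡⟨ cong (binom x k *_) (ℤP.*-identityʳ (binom c J)) ⟩
    binom x k * binom c J
      ∎

ΣFin-suc : ∀ k (f : Fin (suc k) → ℤ) → ΣFin (suc k) f ≡ f Fin.zero + ΣFin k (f ∘ Fin.suc)
ΣFin-suc k f = cong (λ xs → f Fin.zero + foldr _+_ 0ℤ xs)
  (trans (map-tabulate Fin.suc f) (sym (map-tabulate (λ l → l) (f ∘ Fin.suc))))

module TriangularSystems (n : ℕ) where

  open Congruence n
  open import Relation.Binary.Reasoning.Setoid setoid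

  sum-map-≈0 : ∀ {A : Set} (f : A → ℤ) xs → (∀ x → f x ≈ 0ℤ) → foldr _+_ 0ℤ (map f xs) ≈ 0ℤ
  sum-map-≈0 f [] _ = ≈-refl
  sum-map-≈0 f (x ∷ xs) f≈0 = +-cong (f≈0 x) (sum-map-≈0 f xs f≈0)

  LowerTriangular : ∀ {k} → (Fin k → Fin k → ℤ) → Set
  LowerTriangular A = ∀ j l → j Fin.< l → A j l ≈ 0ℤ

  Pivot : ∀ {k} → (Fin k → Fin k → ℤ) → (Fin k → ℤ) → Fin k → Set
  Pivot A v j = Invertible (A j j) ⊎ ((∀ l → A j l ≈ 0ℤ) × v j ≈ 0ℤ)

  solve-pivot : ∀ {a v} → Invertible a ⊎ (a ≈ 0ℤ × v ≈ 0ℤ) → ∃ λ x → a * x ≈ v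
  solve-pivot {a} {v} (inj₁ (u , au≈1)) = u * v , (begin
    a * (u * v)  ≡⟨ ℤP.*-assoc a u v ⟨
    a * u * v    ≈⟨ *-cong au≈1 (≈-refl {v}) ⟩
    1ℤ * v       ≡⟨ ℤP.*-identityˡ v ⟩
    v            ∎)
  solve-pivot {a} (inj₂ (a≈0 , v≈0)) = 0ℤ , ≈-trans (≈-reflexive (ℤP.*-zeroʳ a)) (≈-sym v≈0)

  forward-substitution : ∀ k (A : Fin k → Fin k → ℤ) (v : Fin k → ℤ) →
    LowerTriangular A → (∀ j → Pivot A v j) →
    Σ (Fin k → ℤ) λ X → ∀ j → ΣFin k (λ l → A j l * X l) ≈ v j
  forward-substitution zero A v _ _ = (λ ()) , (λ ())
  forward-substitution (suc k) A v lower pivots = X , solves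
    where
      first : ∃ λ x → A Fin.zero Fin.zero * x ≈ v Fin.zero
      first = solve-pivot (Sum.map₂ (Product.map₁ (λ row≈0 → row≈0 Fin.zero)) (pivots Fin.zero))
      x₀ = proj₁ first
      A₁ : Fin k → Fin k → ℤ
      A₁ j l = A (Fin.suc j) (Fin.suc l)
      v₁ : Fin k → ℤ
      v₁ j = v (Fin.suc j) - A (Fin.suc j) Fin.zero * x₀
      pivots₁ : ∀ j → Pivot A₁ v₁ j
      pivots₁ j = Sum.map₂
        (λ (row≈0 , v≈0) → row≈0 ∘ Fin.suc , +-cong v≈0 (-‿cong (a≈0⇒a*b≈0 x₀ (row≈0 Fin.zero))))
        (pivots (Fin.suc j))
      rest = forward-substitution k A₁ v₁ (λ j l → lower (Fin.suc j) (Fin.suc l) ∘ s≤s) pivots₁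
      X : Fin (suc k) → ℤ
      X Fin.zero = x₀
      X (Fin.suc l) = proj₁ rest l
      solves : ∀ j → ΣFin (suc k) (λ l → A j l * X l) ≈ v j
      solves Fin.zero = begin
        ΣFin (suc k) (λ l → A Fin.zero l * X l)
          ≡⟨ ΣFin-suc k (λ l → A Fin.zero l * X l) ⟩
        A Fin.zero Fin.zero * x₀ + ΣFin k (λ l → A Fin.zero (Fin.suc l) * X (Fin.suc l))
          ≈⟨ +-cong (proj₂ first) (sum-map-≈0 _ (allFin k) (λ l →
                a≈0⇒a*b≈0 (X (Fin.suc l)) (lower Fin.zero (Fin.suc l) z<s))) ⟩
        v Fin.zero + 0ℤ
          ≡⟨ ℤP.+-identityʳ (v Fin.zero) ⟩
        v Fin.zero
          ∎
      solves (Fin.suc j) = begin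
        ΣFin (suc k) (λ l → A (Fin.suc j) l * X l)
          ≡⟨ ΣFin-suc k (λ l → A (Fin.suc j) l * X l) ⟩
        A (Fin.suc j) Fin.zero * x₀ + ΣFin k (λ l → A₁ j l * proj₁ rest l)
          ≈⟨ +-cong (≈-refl {A (Fin.suc j) Fin.zero * x₀}) (proj₂ rest j) ⟩
        A (Fin.suc j) Fin.zero * x₀ + v₁ j
          ≡⟨ a+[b-a]≡b (A (Fin.suc j) Fin.zero * x₀) (v (Fin.suc j)) ⟩
        v (Fin.suc j)
          ∎
        where a+[b-a]≡b : ∀ a b → a + (b - a) ≡ b
              a+[b-a]≡b = solve-∀

if-true : ∀ {A : Set} {b} {x y : A} → T b → (if b then x else y) ≡ x
if-true {b = true} _ = refl

if-false : ∀ {A : Set} {b} {x y : A} → ¬ T b → (if b then x else y) ≡ y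
if-false {b = false} _ = refl
if-false {b = true} ¬T = ⊥-elim (¬T tt)

r∸l-in-base-p : ∀ p t b c d l → .{{NonZero p}} → 2 ≤ t → c ≤ b → l ≤ b ∸ c →
  b ℕ.+ c ℕ.* (p ∸ 1) ℕ.+ p ^ t ℕ.* (p ∸ 1) ℕ.* d ∸ l
    ≡ (p ^ (t ∸ 2) ℕ.* (p ∸ 1) ℕ.* d ℕ.* p ℕ.+ c) ℕ.* p ℕ.+ (b ∸ c ∸ l)
r∸l-in-base-p (suc q) (suc (suc t)) b c d l (s≤s (s≤s z≤n)) c≤b l≤b∸c = begin
  b ℕ.+ c ℕ.* q ℕ.+ P ℕ.* q ℕ.* d ∸ l
    ≡⟨ cong (λ b → b ℕ.+ c ℕ.* q ℕ.+ P ℕ.* q ℕ.* d ∸ l) x+l+c≡b ⟨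
  x ℕ.+ l ℕ.+ c ℕ.+ c ℕ.* q ℕ.+ P ℕ.* q ℕ.* d ∸ l
    ≡⟨ cong (_∸ l) (regroup x l c q (suc q ^ t) d) ⟩
  l ℕ.+ ((suc q ^ t ℕ.* q ℕ.* d ℕ.* suc q ℕ.+ c) ℕ.* suc q ℕ.+ x) ∸ l
    ≡⟨ m+n∸m≡n l _ ⟩
  (suc q ^ t ℕ.* q ℕ.* d ℕ.* suc q ℕ.+ c) ℕ.* suc q ℕ.+ x
    ∎
  where
    open ≡-Reasoning
    P = suc q ^ suc (suc t)
    x = b ∸ c ∸ l
    x+l+c≡b : x ℕ.+ l ℕ.+ c ≡ b
    x+l+c≡b = trans (cong (ℕ._+ c) (m∸n+n≡m l≤b∸c)) (m∸n+n≡m c≤b)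
    regroup : ∀ x l c q P d → x ℕ.+ l ℕ.+ c ℕ.+ c ℕ.* q ℕ.+ suc q ℕ.* (suc q ℕ.* P) ℕ.* q ℕ.* d
                            ≡ l ℕ.+ ((P ℕ.* q ℕ.* d ℕ.* suc q ℕ.+ c) ℕ.* suc q ℕ.+ x)
    regroup = ℕ-Solver.solve-∀

n+J*[p∸1]≡J*p+[n∸J] : ∀ p n J → .{{NonZero p}} → J ≤ n → n ℕ.+ J ℕ.* (p ∸ 1) ≡ J ℕ.* p ℕ.+ (n ∸ J)
n+J*[p∸1]≡J*p+[n∸J] (suc q) n J J≤n =
  trans (cong (ℕ._+ J ℕ.* q) (sym (m+[n∸m]≡n J≤n))) (regroup J (n ∸ J) q)
  where regroup : ∀ J k q → J ℕ.+ k ℕ.+ J ℕ.* q ≡ J ℕ.* suc q ℕ.+ k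
        regroup = ℕ-Solver.solve-∀

m+[n∸m∸1+o]<n : ∀ {m n} o → m < n → m ℕ.+ (n ∸ m ∸ suc o) < n
m+[n∸m∸1+o]<n {m} {n} o m<n = begin-strict
  m ℕ.+ (n ∸ m ∸ suc o)  ≤⟨ +-monoʳ-≤ m (∸-monoʳ-≤ (n ∸ m) (s≤s z≤n)) ⟩
  m ℕ.+ (n ∸ m ∸ 1)      <⟨ +-monoʳ-< m (∸-monoʳ-< z<s (m<n⇒0<n∸m m<n)) ⟩
  m ℕ.+ (n ∸ m)          ≡⟨ m+[n∸m]≡n (<⇒≤ m<n) ⟩
  n                      ∎
  where open ≤-Reasoning

m+[j+[n∸m]]≡n+j : ∀ {m n} j → m ≤ n → m ℕ.+ (j ℕ.+ (n ∸ m)) ≡ n ℕ.+ j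
m+[j+[n∸m]]≡n+j {m} {n} j m≤n = begin
  m ℕ.+ (j ℕ.+ (n ∸ m))  ≡⟨ cong (m ℕ.+_) (+-comm j (n ∸ m)) ⟩
  m ℕ.+ ((n ∸ m) ℕ.+ j)  ≡⟨ +-assoc m (n ∸ m) j ⟨
  m ℕ.+ (n ∸ m) ℕ.+ j    ≡⟨ cong (ℕ._+ j) (m+[n∸m]≡n m≤n) ⟩
  n ℕ.+ j                ∎
  where open ≡-Reasoning

module AlphaModP {p : ℕ} (p-prime : Prime p) (b c t d m : ℕ) (2≤t : 2 ≤ t) (b≤p : b ≤ p)
  (c<p : c < p) (1≤m : 1 ≤ m) (m<c : m < c) (m≤b∸c : m ≤ b ∸ c) where

  open Congruence p
  open BinomialsModPrime p-prime using (lucas₂)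
  open TriangularSystems p
  open import Relation.Binary.Reasoning.Setoid setoid

  r : ℕ
  r = b ℕ.+ c ℕ.* (p ∸ 1) ℕ.+ p ^ t ℕ.* (p ∸ 1) ℕ.* d

  open Alpha p b c r m

  α₀ : ℕ → ℕ → ℤ
  α₀ i l = binom (r ∸ l) (b ∸ m ℕ.+ (i ℕ.+ c ∸ m ∸ 1) ℕ.* (p ∸ 1))

  instance
    p≢0 : NonZero p
    p≢0 = prime⇒nonZero p-prime

  c≤b : c ≤ b
  c≤b = <⇒≤ (m∸n≢0⇒n<m (λ b∸c≡0 → <⇒≱ (≤-trans 1≤m m≤b∸c) (≤-reflexive b∸c≡0)))

  m≤b : m ≤ b
  m≤b = ≤-trans m≤b∸c (m∸n≤m b c)

  j+[c∸m]<c : ∀ {j} → j < m → j ℕ.+ (c ∸ m) < c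
  j+[c∸m]<c j<m = subst (_ ℕ.+ (c ∸ m) <_) (m+[n∸m]≡n (<⇒≤ m<c)) (+-monoˡ-< (c ∸ m) j<m)

  entry≈ : ∀ l J → l ≤ b ∸ c → J ≤ b ∸ m → J < p →
           binom (r ∸ l) (b ∸ m ℕ.+ J ℕ.* (p ∸ 1)) ≈ binom (b ∸ c ∸ l) (b ∸ m ∸ J) * binom c J
  entry≈ l J l≤b∸c J≤b∸m J<p = begin
    binom (r ∸ l) (b ∸ m ℕ.+ J ℕ.* (p ∸ 1))
      ≡⟨ cong₂ binom (r∸l-in-base-p p t b c d l 2≤t c≤b l≤b∸c) (n+J*[p∸1]≡J*p+[n∸J] p (b ∸ m) J J≤b∸m) ⟩
    binom ((p ^ (t ∸ 2) ℕ.* (p ∸ 1) ℕ.* d ℕ.* p ℕ.+ c) ℕ.* p ℕ.+ (b ∸ c ∸ l)) (J ℕ.* p ℕ.+ (b ∸ m ∸ J))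
      ≈⟨ lucas₂ (p ^ (t ∸ 2) ℕ.* (p ∸ 1) ℕ.* d) c (b ∸ c ∸ l) J (b ∸ m ∸ J) c<p x<p J<p k<p ⟩
    binom (b ∸ c ∸ l) (b ∸ m ∸ J) * binom c J
      ∎
    where
      x<p : b ∸ c ∸ l < p
      x<p = ≤-<-trans (m∸n≤m (b ∸ c) l) (<-≤-trans (∸-monoʳ-< (≤-<-trans z≤n m<c) c≤b) b≤p)
      k<p : b ∸ m ∸ J < p
      k<p = ≤-<-trans (m∸n≤m (b ∸ m) J) (<-≤-trans (∸-monoʳ-< 1≤m m≤b) b≤p)

  entry≈0 : ∀ l J → l ≤ b ∸ c → J ≤ b ∸ m → J < p → b ∸ c ∸ l < b ∸ m ∸ J →
            binom (r ∸ l) (b ∸ m ℕ.+ J ℕ.* (p ∸ 1)) ≈ 0ℤ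
  entry≈0 l J l≤b∸c J≤b∸m J<p x<k =
    ≈-trans (entry≈ l J l≤b∸c J≤b∸m J<p) (a≈0⇒a*b≈0 (binom c J) (≈-reflexive (n<k⇒binom≡0 x<k)))

  -- Every summand vanishes, whatever the upper limit c − m − ε₁ of the sum.
  α₁≈0 : ∀ i l → l ≤ m → α₁ i l ≈ 0ℤ
  α₁≈0 i l l≤m = b≈0⇒a*b≈0 (sgn (suc i)) (sum-map-≈0 _ (upTo (suc (c ∸ m ∸ ε₁) ∸ 1)) term≈0)
    where
      term≈0 : ∀ a → binom (r ∸ l) (b ∸ m ℕ.+ (c ∸ m ∸ suc a) ℕ.* (p ∸ 1)) * β (suc a) i ≈ 0ℤ
      term≈0 a = a≈0⇒a*b≈0 (β (suc a) i) (entry≈0 l J (≤-trans l≤m m≤b∸c) J≤b∸m J<p x<k)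
        where
          J = c ∸ m ∸ suc a
          J≤b∸m : J ≤ b ∸ m
          J≤b∸m = ≤-trans (m∸n≤m (c ∸ m) (suc a)) (∸-monoˡ-≤ m c≤b)
          J<p : J < p
          J<p = ≤-<-trans (≤-trans (m∸n≤m (c ∸ m) (suc a)) (m∸n≤m c m)) c<p
          x<k : b ∸ c ∸ l < b ∸ m ∸ J
          x<k = ≤-<-trans (m∸n≤m (b ∸ c) l)
                  (subst (b ∸ c <_) (sym (∸-+-assoc b m J)) (∸-monoʳ-< (m+[n∸m∸1+o]<n a m<c) c≤b))

  α₀≈ : ∀ j l → j < m → l ≤ m →
        α₀ (suc j) l ≈ binom (b ∸ c ∸ l) (b ∸ c ∸ j) * binom c (j ℕ.+ (c ∸ m))
  α₀≈ j l j<m l≤m = begin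
    α₀ (suc j) l
      ≡⟨ cong (λ J → binom (r ∸ l) (b ∸ m ℕ.+ J ℕ.* (p ∸ 1))) (cong (_∸ 1) (+-∸-assoc (suc j) m≤c)) ⟩
    binom (r ∸ l) (b ∸ m ℕ.+ J ℕ.* (p ∸ 1))
      ≈⟨ entry≈ l J (≤-trans l≤m m≤b∸c) J≤b∸m (<-trans (j+[c∸m]<c j<m) c<p) ⟩
    binom (b ∸ c ∸ l) (b ∸ m ∸ J) * binom c J
      ≡⟨ cong (λ k → binom (b ∸ c ∸ l) k * binom c J) b∸m∸J≡b∸c∸j ⟩
    binom (b ∸ c ∸ l) (b ∸ c ∸ j) * binom c J
      ∎
    where
      J = j ℕ.+ (c ∸ m)
      m≤c = <⇒≤ m<c
      m+J≡c+j : m ℕ.+ J ≡ c ℕ.+ j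
      m+J≡c+j = m+[j+[n∸m]]≡n+j j m≤c
      J≤b∸m : J ≤ b ∸ m
      J≤b∸m = m+n≤o⇒m≤o∸n J (subst (_≤ b) (trans (+-comm j c) (trans (sym m+J≡c+j) (+-comm m J)))
                                   (m≤o∸n⇒m+n≤o j c≤b (≤-trans (<⇒≤ j<m) m≤b∸c)))
      b∸m∸J≡b∸c∸j : b ∸ m ∸ J ≡ b ∸ c ∸ j
      b∸m∸J≡b∸c∸j = trans (∸-+-assoc b m J) (trans (cong (b ∸_) m+J≡c+j) (sym (∸-+-assoc b c j)))

  α₀-diagonal : ∀ j → j < m → α₀ (suc j) j ≈ binom c (j ℕ.+ (c ∸ m))
  α₀-diagonal j j<m = begin
    α₀ (suc j) j
      ≈⟨ α₀≈ j j j<m (<⇒≤ j<m) ⟩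
    binom (b ∸ c ∸ j) (b ∸ c ∸ j) * binom c (j ℕ.+ (c ∸ m))
      ≡⟨ cong (λ x → + x * binom c (j ℕ.+ (c ∸ m))) (nCn≡1 (b ∸ c ∸ j)) ⟩
    1ℤ * binom c (j ℕ.+ (c ∸ m))
      ≡⟨ ℤP.*-identityˡ (binom c (j ℕ.+ (c ∸ m))) ⟩
    binom c (j ℕ.+ (c ∸ m))
      ∎

  α₀-above-diagonal : ∀ j l → j < l → l ≤ m → α₀ (suc j) l ≈ 0ℤ
  α₀-above-diagonal j l j<l l≤m =
    ≈-trans (α₀≈ j l (<-≤-trans j<l l≤m) l≤m)
            (a≈0⇒a*b≈0 (binom c (j ℕ.+ (c ∸ m)))
                       (≈-reflexive (n<k⇒binom≡0 (∸-monoʳ-< j<l (≤-trans l≤m m≤b∸c)))))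

  α-row : ∀ j l → j < m → l ≤ m → α (suc j) l ≈ α₀ (suc j) l
  α-row j l j<m l≤m = begin
    α (suc j) l                  ≡⟨ if-true (≤⇒≤ᵇ j<m) ⟩
    α₁ (suc j) l + α₀ (suc j) l  ≈⟨ +-cong (α₁≈0 (suc j) l l≤m) (≈-refl {α₀ (suc j) l}) ⟩
    0ℤ + α₀ (suc j) l            ≡⟨ ℤP.+-identityˡ (α₀ (suc j) l) ⟩
    α₀ (suc j) l                 ∎

  α-last-row : ∀ l → l ≤ m → α (suc m) l ≈ 0ℤ
  α-last-row l l≤m =
    ≈-trans (≈-reflexive (if-false (<⇒≱ (n<1+n m) ∘ ≤ᵇ⇒≤ (suc m) m))) (α₁≈0 (suc m) l l≤m)

  A : Fin (suc m) → Fin (suc m) → ℤ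
  A j l = α (suc (toℕ j)) (toℕ l)

  e : ℕ → Fin (suc m) → ℤ
  e i j = if suc (toℕ j) ℕ.≡ᵇ i then + 1 else + 0

  A-lower : LowerTriangular A
  A-lower j l j<l = ≈-trans (α-row (toℕ j) (toℕ l) (<-≤-trans j<l (toℕ≤pred[n] l)) (toℕ≤pred[n] l))
                            (α₀-above-diagonal (toℕ j) (toℕ l) j<l (toℕ≤pred[n] l))

  A-pivot : ∀ i → i ≤ m → ∀ j → Pivot A (e i) j
  A-pivot i i≤m j with m≤n⇒m<n∨m≡n (toℕ≤pred[n] j)
  ... | inj₁ j<m = inj₁ (invertible-resp-≈
    (≈-trans (α-row (toℕ j) (toℕ j) j<m (<⇒≤ j<m)) (α₀-diagonal (toℕ j) j<m))
    (prime∤⇒invertible p-prime (prime∤nCk p-prime c<p (<⇒≤ (j+[c∸m]<c j<m)))))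
  ... | inj₂ j≡m = inj₂ (row≈0 , ≈-reflexive (if-false e≢1))
    where
      row≈0 : ∀ l → A j l ≈ 0ℤ
      row≈0 l = subst (λ k → α (suc k) (toℕ l) ≈ 0ℤ) (sym j≡m) (α-last-row (toℕ l) (toℕ≤pred[n] l))
      e≢1 : ¬ T (suc (toℕ j) ℕ.≡ᵇ i)
      e≢1 t = <⇒≱ (s≤s (≤-reflexive (sym j≡m)))
                  (≤-trans (≤-reflexive (≡ᵇ⇒≡ (suc (toℕ j)) i t)) i≤m)

  solution : ∀ i → i ≤ m →
             Σ (Fin (suc m) → ℤ) λ X → ∀ j → ΣFin (suc m) (λ l → A j l * X l) ≈ e i j
  solution i i≤m = forward-substitution (suc m) A (e i) A-lower (A-pivot i i≤m)

lemma5p4 : (p b c t d m : ℕ) → Prime p → 5 ≤ p → 2 ≤ b → b ≤ p → 1 ≤ c → c ≤ p ∸ 1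
    → 2 ≤ t → 1 ≤ d → ¬ (p ℕD.∣ d)
    → c ∸ 1 ≤ b → 1 ≤ m → m ≤ b ∸ c → m ℕ.+ 1 ℕ.+ Alpha.ε p b c (b ℕ.+ c ℕ.* (p ∸ 1) ℕ.+ p ^ t ℕ.* (p ∸ 1) ℕ.* d) m ≤ c
    → (i : ℕ) → 1 ≤ i → i ≤ m
    → Σ (Fin (suc m) → ℤ) λ X → (j : Fin (suc m)) →
        (+ p) ℤD.∣ (ΣFin (suc m) (λ l → Alpha.α p b c (b ℕ.+ c ℕ.* (p ∸ 1) ℕ.+ p ^ t ℕ.* (p ∸ 1) ℕ.* d) m (suc (toℕ j)) (toℕ l) ℤ.* X l)
                    ℤ.- (if suc (toℕ j) ℕ.≡ᵇ i then + 1 else + 0))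
lemma5p4 p b c t d m p-prime _ _ b≤p _ c≤p∸1 2≤t _ _ _ 1≤m m≤b∸c m+1+ε≤c i _ i≤m =
  Product.map₂ (λ solves j → ∣⇒∣ᵤ (divides-difference (solves j))) (solution i i≤m)
  where
    c<p : c < p
    c<p = m≤pred[n]⇒suc[m]≤n {{prime⇒nonZero p-prime}} c≤p∸1
    m<c : m < c
    m<c = subst (_≤ c) (+-comm m 1) (m+n≤o⇒m≤o (m ℕ.+ 1) m+1+ε≤c)
    open AlphaModP p-prime b c t d m 2≤t b≤p c<p 1≤m m<c m≤b∸c
    open Congruence p using (divides-difference)
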